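{- Let $t \ge 3$ and $n\ge 1$ be integers. For every $i \in [n]$ and every $S \subseteq [t]^n$, $|\partial c_i(S)| \le |\partial S|$.
   Context: $K_t^n$ is the graph with vertex set $[t]^n = \{1,\dots,t\}^n$ in which $x,y$ are adjacent iff $x_i \neq y_i$ for all $i \in [n]$. For $S \subseteq [t]^n$, $\partial S := \{x \in [t]^n : \exists y \in S \text{ adjacent to } x \text{ in } K_t^n\}$ (the vertex boundary, possibly containing points of $S$). For $y \in [t]^n$, $y_{\neg i} := (y_1,\dots,y_{i-1},y_{i+1},\dots,y_n)$. The compression of $S$ in coordinate $i$ is $c_i(S) := \{x \in [t]^n : x_i \le |\{y \in S : y_{\neg i} = x_{\neg i}\}|\}$. -}

module Defs where

open import Data.Nat using (ℕ; zero; suc; _≤ᵇ_)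
open import Data.Bool using (Bool; true; false; _∧_; _∨_; not)
open import Data.Fin using (Fin; toℕ; _≟_)
open import Data.List using (List; []; _∷_; [_]; map; concatMap; allFin; filter; length)
open import Data.Bool.ListAction using (any; all)
open import Data.Vec using (Vec; []; _∷_; lookup; _[_]≔_)
open import Relation.Nullary.Decidable using (⌊_⌋)

-- Points of [t]^n; coordinate value a : Fin t stands for the integer toℕ a + 1 ∈ [t].
Point : ℕ → ℕ → Set
Point t n = Vec (Fin t) n

Subset : ℕ → ℕ → Set
Subset t n = Point t n → Bool

allPoints : (t n : ℕ) → List (Point t n)
allPoints t zero    = [ [] ]
allPoints t (suc n) = concatMap (λ a → map (a ∷_) (allPoints t n)) (allFin t)

card : {t n : ℕ} → Subset t n → ℕ
card {t} {n} S = length (filter (λ x → S x Data.Bool.≟ true) (allPoints t n))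

adjacent : {t n : ℕ} → Point t n → Point t n → Bool
adjacent {t} {n} x y = all (λ j → not ⌊ lookup x j ≟ lookup y j ⌋) (allFin n)

boundary : {t n : ℕ} → Subset t n → Subset t n
boundary {t} {n} S x = any (λ y → S y ∧ adjacent x y) (allPoints t n)

agreeOff : {t n : ℕ} → Fin n → Point t n → Point t n → Bool
agreeOff {t} {n} i x y = all (λ j → ⌊ j ≟ i ⌋ ∨ ⌊ lookup x j ≟ lookup y j ⌋) (allFin n)

lineCount : {t n : ℕ} → Fin n → Subset t n → Point t n → ℕ
lineCount {t} {n} i S x =
  length (filter (λ y → (S y ∧ agreeOff i x y) Data.Bool.≟ true) (allPoints t n))

compress : {t n : ℕ} → Fin n → Subset t n → Subset t n
compress i S x = suc (toℕ (lookup x i)) ≤ᵇ lineCount i S x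

-- We inject ∂c_i(S) into ∂S by a map that changes only the i-th coordinate. Given x, let
-- the pivot p be the i-th coordinate of the first z ∈ S differing from x in every
-- coordinate other than i, and map x to the point obtained by swapping the values 1 and p
-- in its i-th coordinate. If x ∈ ∂c_i(S) is witnessed by y ∈ c_i(S), then every point of S
-- on the line through y in direction i differs from x off i, and that line is non-empty, so
-- z exists. The image of x is adjacent to z unless its new i-th coordinate is p, which
-- happens only when x_i = 1; then y_i ≥ 2, so the line through y holds two points of S,
-- and one of them differs from the image in coordinate i as well. The pivot depends only on
-- x_{¬i}, hence the map is injective.
module Submission where

open import Defs
open import Data.Bool using (Bool; true; T; not; _∧_; _∨_)
import Data.Bool as Bool
open import Data.Bool.Properties using (T-≡; T-∧; T-∨; T?)
open import Data.Fin using (Fin; zero; suc; toℕ)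
open import Data.Fin.Properties using (_≟_; all?)
open import Data.Fin.Permutation.Components using (transpose; transpose-inverse)
open import Data.List
  using (List; []; _∷_; _++_; map; concatMap; cartesianProductWith; allFin; filter; length)
open import Data.List.Properties using (length-map; length-removeAt′)
open import Data.List.Membership.Propositional using (_∈_; _─_; lose)
open import Data.List.Membership.Propositional.Properties
  using (∈-filter⁺; ∈-filter⁻; ∈-allFin; ∈-map⁻; ∈-cartesianProductWith⁺)
open import Data.List.Relation.Binary.Subset.Propositional using (_⊆_)
open import Data.List.Relation.Unary.All as All using ()
open import Data.List.Relation.Unary.All.Properties using (all⁺; all⁻)
open import Data.List.Relation.Unary.Any as Any using (here; there; any?)
open import Data.List.Relation.Unary.Any.Properties using (any⁺; any⁻)
open import Data.List.Relation.Unary.Unique.Propositional using (Unique; []; _∷_)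
open import Data.List.Relation.Unary.Unique.Propositional.Properties
  using (map⁺; filter⁺; cartesianProductWith⁺; allFin⁺)
open import Data.Nat using (ℕ; suc; _≤_; z≤n; s≤s)
open import Data.Nat.Properties using (≤ᵇ⇒≤; ≤-trans; module ≤-Reasoning)
open import Data.Product using (∃; ∃₂; _×_; _,_; proj₁; proj₂)
open import Data.Sum using (inj₁; inj₂)
open import Data.Vec using (Vec; []; _∷_; lookup; _[_]≔_)
open import Data.Vec.Properties using (∷-injective; lookup∘update; lookup∘update′)
open import Function using (_∘_; Injective)
open import Function.Bundles using (Equivalence)
open import Relation.Binary.PropositionalEquality
open import Relation.Nullary using (yes; no; contradiction; ¬?; _×-dec_; _→-dec_; Dec)
open import Relation.Nullary.Decidable
  using (⌊_⌋; map′; dec-true; toWitness; toWitnessFalse; fromWitnessFalse)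
open import Relation.Unary using (Decidable)

private
  variable
    A B C : Set
    m n t : ℕ
    a b : A
    xs ys : List A
    i : Fin n
    x y z : Point t n

open Equivalence using (to; from)

∈-─ : (a∈ys : a ∈ ys) → b ∈ ys → b ≢ a → b ∈ ys ─ a∈ys
∈-─ (here refl) (here refl) b≢a = contradiction refl b≢a
∈-─ (here refl) (there b∈ys) _ = b∈ys
∈-─ (there a∈ys) (here refl) _ = here refl
∈-─ (there a∈ys) (there b∈ys) b≢a = there (∈-─ a∈ys b∈ys b≢a)

unique-⊆⇒length≤ : Unique xs → xs ⊆ ys → length xs ≤ length ys
unique-⊆⇒length≤ {xs = []} _ _ = z≤n
unique-⊆⇒length≤ {xs = a ∷ xs} {ys} (a∉xs ∷ xs!) a∷xs⊆ys = begin
  suc (length xs)          ≤⟨ s≤s (unique-⊆⇒length≤ xs! xs⊆ys─a) ⟩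
  suc (length (ys ─ a∈ys)) ≡⟨ length-removeAt′ ys (Any.index a∈ys) ⟨
  length ys                ∎
  where
  open ≤-Reasoning
  a∈ys : a ∈ ys
  a∈ys = a∷xs⊆ys (here refl)
  xs⊆ys─a : xs ⊆ ys ─ a∈ys
  xs⊆ys─a b∈xs = ∈-─ a∈ys (a∷xs⊆ys (there b∈xs)) (All.lookup a∉xs b∈xs ∘ sym)

length≥1⇒∈ : 1 ≤ length xs → ∃ λ a → a ∈ xs
length≥1⇒∈ {xs = a ∷ _} _ = a , here refl

unique∧length≥2⇒∃≢ : Unique xs → 2 ≤ length xs → ∃₂ λ a b → a ∈ xs × b ∈ xs × a ≢ b
unique∧length≥2⇒∃≢ {xs = _ ∷ []} _ (s≤s ())
unique∧length≥2⇒∃≢ {xs = a ∷ b ∷ _} ((a≢b All.∷ _) ∷ _) _ =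
  a , b , here refl , there (here refl) , a≢b

concatMap-map≡cartesianProductWith : (f : A → B → C) (xs : List A) (ys : List B) →
  concatMap (λ a → map (f a) ys) xs ≡ cartesianProductWith f xs ys
concatMap-map≡cartesianProductWith f [] ys = refl
concatMap-map≡cartesianProductWith f (a ∷ xs) ys =
  cong (map (f a) ys ++_) (concatMap-map≡cartesianProductWith f xs ys)

transpose-matchˡ : (i j : Fin m) → transpose i j i ≡ j
transpose-matchˡ i j rewrite dec-true (i ≟ i) refl = refl

transpose-injective : (i j : Fin m) → Injective _≡_ _≡_ (transpose i j)
transpose-injective i j {k} {l} eq = begin
  k                              ≡⟨ transpose-inverse j i ⟨
  transpose j i (transpose i j k) ≡⟨ cong (transpose j i) eq ⟩
  transpose j i (transpose i j l) ≡⟨ transpose-inverse j i ⟩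
  l                              ∎
  where open ≡-Reasoning

transpose[k]≡j⇒k≡i : (i j : Fin m) {k : Fin m} → transpose i j k ≡ j → k ≡ i
transpose[k]≡j⇒k≡i i j {k} eq = transpose-injective i j (trans eq (sym (transpose-matchˡ i j)))

2≤suc-toℕ : {a : Fin (suc m)} → a ≢ zero → 2 ≤ suc (toℕ a)
2≤suc-toℕ {a = zero} a≢0 = contradiction refl a≢0
2≤suc-toℕ {a = suc _} _ = s≤s (s≤s z≤n)

record Adjacent (x y : Point t n) : Set where
  constructor mkAdjacent
  field differs : ∀ j → lookup x j ≢ lookup y j

record AgreeOff (i : Fin n) (x y : Point t n) : Set where
  constructor mkAgreeOff
  field agrees : ∀ j → j ≢ i → lookup x j ≡ lookup y j

record AdjacentOff (i : Fin n) (x y : Point t n) : Set where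
  constructor mkAdjacentOff
  field differsOff : ∀ j → j ≢ i → lookup x j ≢ lookup y j

open Adjacent
open AgreeOff
open AdjacentOff

adjacentOff? : (i : Fin n) (x y : Point t n) → Dec (AdjacentOff i x y)
adjacentOff? i x y = map′ mkAdjacentOff differsOff
  (all? λ j → ¬? (j ≟ i) →-dec ¬? (lookup x j ≟ lookup y j))

agreeOff-sym : AgreeOff i x y → AgreeOff i y x
agreeOff-sym x≈y = mkAgreeOff λ j j≢i → sym (agrees x≈y j j≢i)

agreeOff-trans : AgreeOff i x y → AgreeOff i y z → AgreeOff i x z
agreeOff-trans x≈y y≈z = mkAgreeOff λ j j≢i → trans (agrees x≈y j j≢i) (agrees y≈z j j≢i)

adjacentOff-respˡ : AgreeOff i x y → AdjacentOff i x z → AdjacentOff i y z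
adjacentOff-respˡ x≈y x~z =
  mkAdjacentOff λ j j≢i → differsOff x~z j j≢i ∘ trans (agrees x≈y j j≢i)

adjacent∧agreeOff⇒adjacentOff : Adjacent x y → AgreeOff i y z → AdjacentOff i x z
adjacent∧agreeOff⇒adjacentOff x~y y≈z =
  mkAdjacentOff λ j j≢i eq → differs x~y j (trans eq (sym (agrees y≈z j j≢i)))

lookup-extensionality : {u v : Vec A n} → (∀ j → lookup u j ≡ lookup v j) → u ≡ v
lookup-extensionality {u = []} {[]} _ = refl
lookup-extensionality {u = _ ∷ _} {_ ∷ _} eq =
  cong₂ _∷_ (eq zero) (lookup-extensionality (eq ∘ suc))

agreeOff⇒≡ : AgreeOff i x y → lookup x i ≡ lookup y i → x ≡ y
agreeOff⇒≡ {i = i} {x = x} {y = y} x≈y xᵢ≡yᵢ = lookup-extensionality agree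
  where
  agree : ∀ j → lookup x j ≡ lookup y j
  agree j with j ≟ i
  ... | yes refl = xᵢ≡yᵢ
  ... | no j≢i = agrees x≈y j j≢i

module _ {i : Fin n} (x : Point t n) {a : Fin t} where

  []≔-agreeOff : AgreeOff i x (x [ i ]≔ a)
  []≔-agreeOff = mkAgreeOff λ j j≢i → sym (lookup∘update′ j≢i x a)

  []≔-adjacent : {w : Point t n} → AdjacentOff i x w → a ≢ lookup w i → Adjacent (x [ i ]≔ a) w
  []≔-adjacent {w} x~w a≢wᵢ = mkAdjacent differ
    where
    differ : ∀ j → lookup (x [ i ]≔ a) j ≢ lookup w j
    differ j with j ≟ i
    ... | yes refl = subst (_≢ lookup w i) (sym (lookup∘update i x a)) a≢wᵢ
    ... | no j≢i = subst (_≢ lookup w j) (agrees []≔-agreeOff j j≢i) (differsOff x~w j j≢i)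

agreeOff⇒[]≔-≡ : {a : Fin t} → AgreeOff i x y → x [ i ]≔ a ≡ y [ i ]≔ a
agreeOff⇒[]≔-≡ {i = i} {x = x} {y = y} {a = a} x≈y = agreeOff⇒≡
  (agreeOff-trans (agreeOff-sym ([]≔-agreeOff x)) (agreeOff-trans x≈y ([]≔-agreeOff y)))
  (trans (lookup∘update i x a) (sym (lookup∘update i y a)))

allPoints-suc : allPoints t (suc n) ≡ cartesianProductWith _∷_ (allFin t) (allPoints t n)
allPoints-suc {t = t} {n = n} = concatMap-map≡cartesianProductWith _∷_ (allFin t) (allPoints t n)

∈-allPoints : (x : Point t n) → x ∈ allPoints t n
∈-allPoints [] = here refl
∈-allPoints (a ∷ x) =
  subst (_ ∈_) (sym allPoints-suc) (∈-cartesianProductWith⁺ _∷_ (∈-allFin a) (∈-allPoints x))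

allPoints-unique : (t n : ℕ) → Unique (allPoints t n)
allPoints-unique t 0 = All.[] ∷ []
allPoints-unique t (suc n) = subst Unique (sym allPoints-suc)
  (cartesianProductWith⁺ _∷_ ∷-injective (allFin⁺ t) (allPoints-unique t n))

members : Subset t n → List (Point t n)
members {t} {n} P = filter (λ x → P x Bool.≟ true) (allPoints t n)

module _ {P : Subset t n} where

  ∈-members⁺ : {x : Point t n} → T (P x) → x ∈ members P
  ∈-members⁺ {x} Px = ∈-filter⁺ _ (∈-allPoints x) (to T-≡ Px)

  ∈-members⁻ : {x : Point t n} → x ∈ members P → T (P x)
  ∈-members⁻ x∈P = from T-≡ (proj₂ (∈-filter⁻ _ {xs = allPoints t n} x∈P))

  members-unique : Unique (members P)
  members-unique = filter⁺ _ (allPoints-unique t n)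

card-mono : {P Q : Subset t n} (f : Point t n → Point t n) → Injective _≡_ _≡_ f →
            (∀ x → T (P x) → T (Q (f x))) → card P ≤ card Q
card-mono {P = P} {Q} f f-injective P⇒Q = begin
  card P                     ≡⟨ length-map f (members P) ⟨
  length (map f (members P)) ≤⟨ unique-⊆⇒length≤ (map⁺ f-injective members-unique) image⊆Q ⟩
  card Q                     ∎
  where
  open ≤-Reasoning
  image⊆Q : map f (members P) ⊆ members Q
  image⊆Q y∈image with x , x∈P , refl ← ∈-map⁻ f y∈image = ∈-members⁺ (P⇒Q x (∈-members⁻ x∈P))

adjacent⁻ : T (adjacent x y) → Adjacent x y
adjacent⁻ x~y = mkAdjacent λ j → toWitnessFalse (All.lookup (all⁺ _ _ x~y) (∈-allFin j))

adjacent⁺ : Adjacent x y → T (adjacent x y)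
adjacent⁺ {x = x} {y = y} x~y = all⁻ (λ j → not ⌊ lookup x j ≟ lookup y j ⌋) {xs = allFin _}
  (All.tabulate λ {j} _ → fromWitnessFalse (differs x~y j))

agreeOff⁻ : T (agreeOff i x y) → AgreeOff i x y
agreeOff⁻ {i = i} {x = x} {y = y} x≈y = mkAgreeOff agree
  where
  disagreeOrAgree : Fin _ → Bool
  disagreeOrAgree j = ⌊ j ≟ i ⌋ ∨ ⌊ lookup x j ≟ lookup y j ⌋
  agree : ∀ j → j ≢ i → lookup x j ≡ lookup y j
  agree j j≢i
    with to (T-∨ {⌊ j ≟ i ⌋}) (All.lookup (all⁺ disagreeOrAgree (allFin _) x≈y) (∈-allFin j))
  ... | inj₁ j≡i = contradiction (toWitness j≡i) j≢i
  ... | inj₂ xⱼ≡yⱼ = toWitness xⱼ≡yⱼ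

module _ {S : Subset t n} {x : Point t n} where

  boundary⁻ : T (boundary S x) → ∃ λ y → T (S y) × Adjacent x y
  boundary⁻ x∈∂S =
    let y , Sy∧x~y = Any.satisfied (any⁻ (λ y → S y ∧ adjacent x y) (allPoints t n) x∈∂S)
        Sy , x~y = to T-∧ Sy∧x~y
    in y , Sy , adjacent⁻ x~y

  boundary⁺ : {y : Point t n} → T (S y) → Adjacent x y → T (boundary S x)
  boundary⁺ {y} Sy x~y =
    any⁺ (λ y → S y ∧ adjacent x y) (lose (∈-allPoints y) (from T-∧ (Sy , adjacent⁺ x~y)))

module Line (i : Fin n) (S : Subset t n) where

  compress⁻ : (y : Point t n) → T (compress i S y) → suc (toℕ (lookup y i)) ≤ lineCount i S y
  compress⁻ y = ≤ᵇ⇒≤ _ _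

  private
    onLine : Point t n → Subset t n
    onLine y w = S w ∧ agreeOff i y w

    ∈-line⁻ : {y w : Point t n} → w ∈ members (onLine y) → T (S w) × AgreeOff i y w
    ∈-line⁻ w∈line = let Sw , y≈w = to T-∧ (∈-members⁻ w∈line) in Sw , agreeOff⁻ y≈w

  line-nonempty : (y : Point t n) → 1 ≤ lineCount i S y → ∃ λ w → T (S w) × AgreeOff i y w
  line-nonempty y count =
    let w , w∈line = length≥1⇒∈ {xs = members (onLine y)} count in w , ∈-line⁻ w∈line

  line-avoids : (y : Point t n) → 2 ≤ lineCount i S y →
                ∀ a → ∃ λ w → T (S w) × AgreeOff i y w × lookup w i ≢ a
  line-avoids y count a
    with w , w′ , w∈line , w′∈line , w≢w′ ← unique∧length≥2⇒∃≢ (members-unique {P = onLine y}) count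
    with Sw , y≈w ← ∈-line⁻ w∈line | Sw′ , y≈w′ ← ∈-line⁻ w′∈line | lookup w i ≟ a
  ... | no wᵢ≢a = w , Sw , y≈w , wᵢ≢a
  ... | yes wᵢ≡a = w′ , Sw′ , y≈w′ , λ w′ᵢ≡a →
    w≢w′ (agreeOff⇒≡ (agreeOff-trans (agreeOff-sym y≈w) y≈w′) (trans wᵢ≡a (sym w′ᵢ≡a)))

module Shift {t n : ℕ} (i : Fin n) (S : Subset (suc t) n) where

  open Line i S

  private
    Candidate : Point (suc t) n → Point (suc t) n → Set
    Candidate u z = T (S z) × AdjacentOff i u z

    candidate? : (u : Point (suc t) n) → Decidable (Candidate u)
    candidate? u z = T? (S z) ×-dec adjacentOff? i u z

    firstPivot : Point (suc t) n → Fin (suc t)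
    firstPivot u with any? (candidate? u) (allPoints (suc t) n)
    ... | yes found = lookup (proj₁ (Any.satisfied found)) i
    ... | no _ = zero

    firstPivot-spec : {u w : Point (suc t) n} → Candidate u w →
                      ∃ λ z → Candidate u z × lookup z i ≡ firstPivot u
    firstPivot-spec {u} {w} w-candidate with any? (candidate? u) (allPoints (suc t) n)
    ... | yes found = proj₁ (Any.satisfied found) , proj₂ (Any.satisfied found) , refl
    ... | no none = contradiction (lose (∈-allPoints w) w-candidate) none

  -- Evaluated at x [ i ]≔ zero so that the pivot is constant on lines in direction i.
  pivot : Point (suc t) n → Fin (suc t)
  pivot x = firstPivot (x [ i ]≔ zero)

  pivot-spec : {x w : Point (suc t) n} → T (S w) → AdjacentOff i x w →
               ∃ λ z → T (S z) × AdjacentOff i x z × lookup z i ≡ pivot x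
  pivot-spec {x} Sw x~w =
    let z , (Sz , u~z) , zᵢ≡p = firstPivot-spec (Sw , adjacentOff-respˡ ([]≔-agreeOff x) x~w)
    in z , Sz , adjacentOff-respˡ (agreeOff-sym ([]≔-agreeOff x)) u~z , zᵢ≡p

  shift : Point (suc t) n → Point (suc t) n
  shift x = x [ i ]≔ transpose zero (pivot x) (lookup x i)

  shift-injective : Injective _≡_ _≡_ shift
  shift-injective {x} {x′} eq = agreeOff⇒≡ x≈x′ (transpose-injective zero (pivot x) atI)
    where
    open ≡-Reasoning
    x≈x′ : AgreeOff i x x′
    x≈x′ = mkAgreeOff λ j j≢i → begin
      lookup x j          ≡⟨ agrees ([]≔-agreeOff x) j j≢i ⟩
      lookup (shift x) j  ≡⟨ cong (λ v → lookup v j) eq ⟩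
      lookup (shift x′) j ≡⟨ agrees ([]≔-agreeOff x′) j j≢i ⟨
      lookup x′ j         ∎
    atI : transpose zero (pivot x) (lookup x i) ≡ transpose zero (pivot x) (lookup x′ i)
    atI = begin
      transpose zero (pivot x) (lookup x i)   ≡⟨ lookup∘update i x _ ⟨
      lookup (shift x) i                      ≡⟨ cong (λ v → lookup v i) eq ⟩
      lookup (shift x′) i                     ≡⟨ lookup∘update i x′ _ ⟩
      transpose zero (pivot x′) (lookup x′ i) ≡⟨ cong (λ p → transpose zero p (lookup x′ i))
                                                      (cong firstPivot (agreeOff⇒[]≔-≡ x≈x′)) ⟨
      transpose zero (pivot x) (lookup x′ i)  ∎

  ∈-boundary-[]≔-of-long-line : {x y : Point (suc t) n} {a : Fin (suc t)} → Adjacent x y →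
                                2 ≤ lineCount i S y → T (boundary S (x [ i ]≔ a))
  ∈-boundary-[]≔-of-long-line {x} {y} {a} x~y count
    with v , Sv , y≈v , vᵢ≢a ← line-avoids y count a
    = boundary⁺ {x = x [ i ]≔ a} Sv
        ([]≔-adjacent x (adjacent∧agreeOff⇒adjacentOff x~y y≈v) (vᵢ≢a ∘ sym))

  ∈-boundary-[]≔ : {x y : Point (suc t) n} {a : Fin (suc t)} → Adjacent x y →
                   suc (toℕ (lookup y i)) ≤ lineCount i S y →
                   (a ≡ pivot x → lookup x i ≡ zero) → T (boundary S (x [ i ]≔ a))
  ∈-boundary-[]≔ {x} {y} {a} x~y count a≡p⇒xᵢ≡0
    with w , Sw , y≈w ← line-nonempty y (≤-trans (s≤s z≤n) count)
    with z , Sz , x~z , zᵢ≡p ← pivot-spec Sw (adjacent∧agreeOff⇒adjacentOff x~y y≈w)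
    with a ≟ lookup z i
  ... | no a≢zᵢ = boundary⁺ {x = x [ i ]≔ a} Sz ([]≔-adjacent x x~z a≢zᵢ)
  ... | yes a≡zᵢ = ∈-boundary-[]≔-of-long-line x~y (≤-trans (2≤suc-toℕ yᵢ≢0) count)
    where
    yᵢ≢0 : lookup y i ≢ zero
    yᵢ≢0 yᵢ≡0 = differs x~y i (trans (a≡p⇒xᵢ≡0 (trans a≡zᵢ zᵢ≡p)) (sym yᵢ≡0))

  shift-boundary : (x : Point (suc t) n) → T (boundary (compress i S) x) → T (boundary S (shift x))
  shift-boundary x x∈∂cS =
    let y , y∈cS , x~y = boundary⁻ x∈∂cS
    in ∈-boundary-[]≔ x~y (compress⁻ y y∈cS) (transpose[k]≡j⇒k≡i zero (pivot x))

claim2p3 : (t n : ℕ) → 3 ≤ t → 1 ≤ n → (i : Fin n) → (S : Subset t n) →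
    card (boundary (compress i S)) ≤ card (boundary S)
claim2p3 (suc t) n _ _ i S = card-mono shift shift-injective shift-boundary
  where open Shift i S
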